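{- An algebra $\langle A,\land_B,\rightarrowtail,0\rangle$ of type $(2,2,0)$ is a Brignole algebra if and only if it satisfies, for all $x,y,z\in A$, the equations (B1) $(x\rightarrowtail x)\rightarrowtail y=y$; (B3) $x\land_B\sim_B(x\land_B\sim_B y)=x\land_B(x\rightarrowtail y)$; (B4) $x\rightarrowtail(y\land_B z)=(x\rightarrowtail y)\land_B(x\rightarrowtail z)$; (B5) $x\rightarrowtail y=\sim_B y\rightarrowtail\sim_B x$; (B6) $x\rightarrowtail(x\rightarrowtail(y\rightarrowtail(y\rightarrowtail z)))=(x\land_B y)\rightarrowtail((x\land_B y)\rightarrowtail z)$; (B7) $\sim_B(\sim_B x\land_B y)\rightarrowtail(x\rightarrowtail y)=x\rightarrowtail y$; (B9) $x\land_B(y\lor_B z)=(z\land_B x)\lor_B(y\land_B x)$; (B10) $(x\land_B\sim_B x)\land_B(y\lor_B\sim_B y)=x\land_B\sim_B x$, where $\sim_B x:=x\rightarrowtail 0$ and $x\lor_B y:=((x\rightarrowtail 0)\land_B(y\rightarrowtail 0))\rightarrowtail 0$.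
   Context: A Brignole algebra is an algebra $\langle A,\land_B,\rightarrowtail,0\rangle$ of type $(2,2,0)$ satisfying, for all $x,y,z\in A$ (with $\sim_B x:=x\rightarrowtail 0$ and $x\lor_B y:=((x\rightarrowtail 0)\land_B(y\rightarrowtail 0))\rightarrowtail 0$), the equations (B1), (B3), (B4), (B5), (B6), (B7), (B9), (B10) listed in the claim together with (B2) $(x\rightarrowtail y)\land_B y=y$ and (B8) $x\land_B(x\lor_B y)=x$. -}

module Defs where

open import Level using (Level; suc)
open import Relation.Binary.PropositionalEquality using (_≡_)

record Algebra220 (a : Level) : Set (suc a) where
  field
    Carrier : Set a
    _∧B_ : Carrier → Carrier → Carrier
    _↣_ : Carrier → Carrier → Carrier
    𝟘 : Carrier
  infixr 6 _∧B_
  infixr 5 _↣_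

  ∼B : Carrier → Carrier
  ∼B x = x ↣ 𝟘

  _∨B_ : Carrier → Carrier → Carrier
  x ∨B y = ((x ↣ 𝟘) ∧B (y ↣ 𝟘)) ↣ 𝟘

module _ {a : Level} (A : Algebra220 a) where
  open Algebra220 A

  B1 B2 B3 B4 B5 B6 B7 B8 B9 B10 : Set a
  B1 = ∀ x y → (x ↣ x) ↣ y ≡ y
  B2 = ∀ x y → (x ↣ y) ∧B y ≡ y
  B3 = ∀ x y → x ∧B ∼B (x ∧B ∼B y) ≡ x ∧B (x ↣ y)
  B4 = ∀ x y z → x ↣ (y ∧B z) ≡ (x ↣ y) ∧B (x ↣ z)
  B5 = ∀ x y → x ↣ y ≡ ∼B y ↣ ∼B x
  B6 = ∀ x y z → x ↣ (x ↣ (y ↣ (y ↣ z))) ≡ (x ∧B y) ↣ ((x ∧B y) ↣ z)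
  B7 = ∀ x y → ∼B (∼B x ∧B y) ↣ (x ↣ y) ≡ x ↣ y
  B8 = ∀ x y → x ∧B (x ∨B y) ≡ x
  B9 = ∀ x y z → x ∧B (y ∨B z) ≡ (z ∧B x) ∨B (y ∧B x)
  B10 = ∀ x y → (x ∧B ∼B x) ∧B (y ∨B ∼B y) ≡ x ∧B ∼B x

  record IsBrignole : Set a where
    field
      b1 : B1
      b2 : B2
      b3 : B3
      b4 : B4
      b5 : B5
      b6 : B6
      b7 : B7
      b8 : B8
      b9 : B9
      b10 : B10

  record SatisfiesReduced : Set a where
    field
      b1 : B1
      b3 : B3
      b4 : B4
      b5 : B5
      b6 : B6
      b7 : B7
      b9 : B9
      b10 : B10

{-# OPTIONS --safe #-}
module Submission where

open import Defs
open import Level using (Level)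
open import Data.Product using (_×_; _,_)
open import Relation.Binary.PropositionalEquality using (_≡_; sym; trans; cong; cong₂; module ≡-Reasoning)

-- From (B1) and (B5) the negation ∼B is an involution, and (B9) then makes ∧B commutative
-- and idempotent. The heart of the matter is that 𝟘 is the least element: 𝟘 ↣ x ≡ 𝟙, so 𝟙
-- is a unit for ∧B, and from there 𝟘 ∧B x ≡ 𝟘. By (B3)-(B5), x ∧B (y ↣ x) equals
-- ∼B (𝟘 ∧B ∼B y) ↣ x, which is 𝟙 ↣ x ≡ x; this is (B2). By (B9), x ∧B (x ∨B y) equals
-- x ∧B (𝟙 ∨B y) ≡ x ∧B 𝟙 ≡ x; this is (B8).
module ReducedAxiomsConsequences {a : Level} (A : Algebra220 a) (S : SatisfiesReduced A) where
  open Algebra220 A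
  open SatisfiesReduced S
  open ≡-Reasoning

  𝟙 : Carrier
  𝟙 = 𝟘 ↣ 𝟘

  ∼𝟙≡𝟘 : ∼B 𝟙 ≡ 𝟘
  ∼𝟙≡𝟘 = b1 𝟘 𝟘

  ∼-involutive : ∀ x → ∼B (∼B x) ≡ x
  ∼-involutive x = begin
    ∼B x ↣ 𝟘        ≡⟨ cong (∼B x ↣_) (sym ∼𝟙≡𝟘) ⟩
    ∼B x ↣ ∼B 𝟙     ≡⟨ sym (b5 𝟙 x) ⟩
    𝟙 ↣ x           ≡⟨ b1 𝟘 x ⟩
    x               ∎

  x↣x≡𝟙 : ∀ x → x ↣ x ≡ 𝟙
  x↣x≡𝟙 x = trans (sym (∼-involutive (x ↣ x))) (cong ∼B (b1 x 𝟘))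

  ∼x↣y≡∼y↣x : ∀ x y → ∼B x ↣ y ≡ ∼B y ↣ x
  ∼x↣y≡∼y↣x x y = trans (cong (∼B x ↣_) (sym (∼-involutive y))) (sym (b5 (∼B y) x))

  x↣𝟙≡𝟘↣∼x : ∀ x → x ↣ 𝟙 ≡ 𝟘 ↣ ∼B x
  x↣𝟙≡𝟘↣∼x x = trans (b5 x 𝟙) (cong (_↣ ∼B x) ∼𝟙≡𝟘)

  ∼x↣𝟘∧y≡x∧[∼x↣y] : ∀ x y → ∼B x ↣ (𝟘 ∧B y) ≡ x ∧B (∼B x ↣ y)
  ∼x↣𝟘∧y≡x∧[∼x↣y] x y = trans (b4 (∼B x) 𝟘 y) (cong (_∧B (∼B x ↣ y)) (∼-involutive x))

  x↣[∼x∧𝟘]≡∼x : ∀ x → x ↣ (∼B x ∧B 𝟘) ≡ ∼B x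
  x↣[∼x∧𝟘]≡∼x x = trans (b5 x (∼B x ∧B 𝟘)) (b7 x 𝟘)

  𝟘∧𝟘≡𝟘 : 𝟘 ∧B 𝟘 ≡ 𝟘
  𝟘∧𝟘≡𝟘 = begin
    𝟘 ∧B 𝟘              ≡⟨ cong (_∧B 𝟘) (sym ∼𝟙≡𝟘) ⟩
    ∼B 𝟙 ∧B 𝟘           ≡⟨ sym (b1 𝟘 (∼B 𝟙 ∧B 𝟘)) ⟩
    𝟙 ↣ (∼B 𝟙 ∧B 𝟘)     ≡⟨ x↣[∼x∧𝟘]≡∼x 𝟙 ⟩
    ∼B 𝟙                ≡⟨ ∼𝟙≡𝟘 ⟩
    𝟘                   ∎

  ∧-idem : ∀ x → x ∧B x ≡ x
  ∧-idem x = begin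
    x ∧B x                  ≡⟨ cong (x ∧B_) (sym (∼-involutive x)) ⟩
    x ∧B (∼B x ↣ 𝟘)         ≡⟨ sym (∼x↣𝟘∧y≡x∧[∼x↣y] x 𝟘) ⟩
    ∼B x ↣ (𝟘 ∧B 𝟘)         ≡⟨ cong (∼B x ↣_) 𝟘∧𝟘≡𝟘 ⟩
    ∼B (∼B x)               ≡⟨ ∼-involutive x ⟩
    x                       ∎

  -- Idempotence turns y into the join y ∨B y, which (B9) lets us move across the meet.
  ∧-comm : ∀ x y → x ∧B y ≡ y ∧B x
  ∧-comm x y = begin
    x ∧B y                        ≡⟨ cong (x ∧B_) (sym (∼-involutive y)) ⟩
    x ∧B ∼B (∼B y)                ≡⟨ cong (λ h → x ∧B ∼B h) (sym (∧-idem (∼B y))) ⟩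
    x ∧B (y ∨B y)                 ≡⟨ b9 x y y ⟩
    (y ∧B x) ∨B (y ∧B x)          ≡⟨ cong ∼B (∧-idem (∼B (y ∧B x))) ⟩
    ∼B (∼B (y ∧B x))              ≡⟨ ∼-involutive (y ∧B x) ⟩
    y ∧B x                        ∎

  x↣[𝟘∧∼x]≡∼x : ∀ x → x ↣ (𝟘 ∧B ∼B x) ≡ ∼B x
  x↣[𝟘∧∼x]≡∼x x = trans (cong (x ↣_) (∧-comm 𝟘 (∼B x))) (x↣[∼x∧𝟘]≡∼x x)

  ∼x↣[𝟘∧x]≡x : ∀ x → ∼B x ↣ (𝟘 ∧B x) ≡ x
  ∼x↣[𝟘∧x]≡x x = begin
    ∼B x ↣ (𝟘 ∧B x)             ≡⟨ cong (λ h → ∼B x ↣ (𝟘 ∧B h)) (sym (∼-involutive x)) ⟩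
    ∼B x ↣ (𝟘 ∧B ∼B (∼B x))     ≡⟨ x↣[𝟘∧∼x]≡∼x (∼B x) ⟩
    ∼B (∼B x)                   ≡⟨ ∼-involutive x ⟩
    x                           ∎

  x∧[∼x↣x]≡x : ∀ x → x ∧B (∼B x ↣ x) ≡ x
  x∧[∼x↣x]≡x x = trans (sym (∼x↣𝟘∧y≡x∧[∼x↣y] x x)) (∼x↣[𝟘∧x]≡x x)

  x↣[x∧y]≡𝟙∧[x↣y] : ∀ x y → x ↣ (x ∧B y) ≡ 𝟙 ∧B (x ↣ y)
  x↣[x∧y]≡𝟙∧[x↣y] x y = trans (b4 x x y) (cong (_∧B (x ↣ y)) (x↣x≡𝟙 x))

  x↣[y∧x]≡𝟙∧[x↣y] : ∀ x y → x ↣ (y ∧B x) ≡ 𝟙 ∧B (x ↣ y)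
  x↣[y∧x]≡𝟙∧[x↣y] x y = trans (cong (x ↣_) (∧-comm y x)) (x↣[x∧y]≡𝟙∧[x↣y] x y)

  x∧∼[x∧y]≡x∧[x↣∼y] : ∀ x y → x ∧B ∼B (x ∧B y) ≡ x ∧B (x ↣ ∼B y)
  x∧∼[x∧y]≡x∧[x↣∼y] x y = trans (cong (λ h → x ∧B ∼B (x ∧B h)) (sym (∼-involutive y))) (b3 x (∼B y))

  x∧[y↣x]≡∼[𝟘∧∼y]↣x : ∀ x y → x ∧B (y ↣ x) ≡ ∼B (𝟘 ∧B ∼B y) ↣ x
  x∧[y↣x]≡∼[𝟘∧∼y]↣x x y = begin
    x ∧B (y ↣ x)              ≡⟨ cong (x ∧B_) (b5 y x) ⟩
    x ∧B (∼B x ↣ ∼B y)        ≡⟨ sym (∼x↣𝟘∧y≡x∧[∼x↣y] x (∼B y)) ⟩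
    ∼B x ↣ (𝟘 ∧B ∼B y)        ≡⟨ ∼x↣y≡∼y↣x x (𝟘 ∧B ∼B y) ⟩
    ∼B (𝟘 ∧B ∼B y) ↣ x        ∎

  𝟘∧𝟙≡𝟘 : 𝟘 ∧B 𝟙 ≡ 𝟘
  𝟘∧𝟙≡𝟘 = begin
    𝟘 ∧B 𝟙                                    ≡⟨ sym (∼-involutive (𝟘 ∧B 𝟙)) ⟩
    ∼B (∼B (𝟘 ∧B 𝟙))                          ≡⟨ cong ∼B (sym (x↣[𝟘∧∼x]≡∼x (𝟘 ∧B 𝟙))) ⟩
    ∼B ((𝟘 ∧B 𝟙) ↣ (𝟘 ∧B ∼B (𝟘 ∧B 𝟙)))        ≡⟨ cong (λ h → ∼B ((𝟘 ∧B 𝟙) ↣ h)) (b3 𝟘 𝟘) ⟩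
    ∼B ((𝟘 ∧B 𝟙) ↣ (𝟘 ∧B 𝟙))                  ≡⟨ cong ∼B (x↣x≡𝟙 (𝟘 ∧B 𝟙)) ⟩
    ∼B 𝟙                                      ≡⟨ ∼𝟙≡𝟘 ⟩
    𝟘                                         ∎

  x∧[𝟘↣x]≡x : ∀ x → x ∧B (𝟘 ↣ x) ≡ x
  x∧[𝟘↣x]≡x x = begin
    x ∧B (𝟘 ↣ x)            ≡⟨ x∧[y↣x]≡∼[𝟘∧∼y]↣x x 𝟘 ⟩
    ∼B (𝟘 ∧B 𝟙) ↣ x         ≡⟨ cong (λ h → ∼B h ↣ x) 𝟘∧𝟙≡𝟘 ⟩
    𝟙 ↣ x                   ≡⟨ b1 𝟘 x ⟩
    x                       ∎

  𝟘↣𝟙≡𝟙 : 𝟘 ↣ 𝟙 ≡ 𝟙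
  𝟘↣𝟙≡𝟙 = begin
    𝟘 ↣ 𝟙               ≡⟨ sym (∼-involutive (𝟘 ↣ 𝟙)) ⟩
    ∼B n                ≡⟨ cong ∼B n≡𝟘 ⟩
    𝟙                   ∎
    where
    n : Carrier
    n = ∼B (𝟘 ↣ 𝟙)

    𝟘∧[𝟘↣𝟙]≡𝟘 : 𝟘 ∧B (𝟘 ↣ 𝟙) ≡ 𝟘
    𝟘∧[𝟘↣𝟙]≡𝟘 = begin
      𝟘 ∧B (𝟘 ↣ 𝟙)              ≡⟨ sym (b3 𝟘 𝟙) ⟩
      𝟘 ∧B ∼B (𝟘 ∧B ∼B 𝟙)       ≡⟨ cong (λ h → 𝟘 ∧B ∼B (𝟘 ∧B h)) ∼𝟙≡𝟘 ⟩
      𝟘 ∧B ∼B (𝟘 ∧B 𝟘)          ≡⟨ cong (λ h → 𝟘 ∧B ∼B h) 𝟘∧𝟘≡𝟘 ⟩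
      𝟘 ∧B 𝟙                    ≡⟨ 𝟘∧𝟙≡𝟘 ⟩
      𝟘                         ∎

    x∧[n↣x]≡x : ∀ x → x ∧B (n ↣ x) ≡ x
    x∧[n↣x]≡x x = begin
      x ∧B (n ↣ x)              ≡⟨ cong (x ∧B_) (sym (∼x↣y≡∼y↣x x (𝟘 ↣ 𝟙))) ⟩
      x ∧B (∼B x ↣ (𝟘 ↣ 𝟙))     ≡⟨ sym (∼x↣𝟘∧y≡x∧[∼x↣y] x (𝟘 ↣ 𝟙)) ⟩
      ∼B x ↣ (𝟘 ∧B (𝟘 ↣ 𝟙))     ≡⟨ cong (∼B x ↣_) 𝟘∧[𝟘↣𝟙]≡𝟘 ⟩
      ∼B (∼B x)                 ≡⟨ ∼-involutive x ⟩
      x                         ∎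

    n≡𝟘 : n ≡ 𝟘
    n≡𝟘 = begin
      n                             ≡⟨ sym (x∧[n↣x]≡x n) ⟩
      n ∧B (n ↣ n)                  ≡⟨ cong (n ∧B_) (x↣x≡𝟙 n) ⟩
      n ∧B 𝟙                        ≡⟨ ∧-comm n 𝟙 ⟩
      𝟙 ∧B n                        ≡⟨ cong (𝟙 ∧B_) (sym (b1 𝟘 n)) ⟩
      𝟙 ∧B (𝟙 ↣ n)                  ≡⟨ sym (x∧∼[x∧y]≡x∧[x↣∼y] 𝟙 (𝟘 ↣ 𝟙)) ⟩
      𝟙 ∧B ∼B (𝟙 ∧B (𝟘 ↣ 𝟙))        ≡⟨ cong (λ h → 𝟙 ∧B ∼B h) (x∧[𝟘↣x]≡x 𝟙) ⟩
      𝟙 ∧B ∼B 𝟙                     ≡⟨ cong (𝟙 ∧B_) ∼𝟙≡𝟘 ⟩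
      𝟙 ∧B 𝟘                        ≡⟨ ∧-comm 𝟙 𝟘 ⟩
      𝟘 ∧B 𝟙                        ≡⟨ 𝟘∧𝟙≡𝟘 ⟩
      𝟘                             ∎

  𝟘↣[𝟙∧y]≡𝟘↣[𝟘∧y] : ∀ y → 𝟘 ↣ (𝟙 ∧B y) ≡ 𝟘 ↣ (𝟘 ∧B y)
  𝟘↣[𝟙∧y]≡𝟘↣[𝟘∧y] y = begin
    𝟘 ↣ (𝟙 ∧B y)                ≡⟨ b4 𝟘 𝟙 y ⟩
    (𝟘 ↣ 𝟙) ∧B (𝟘 ↣ y)          ≡⟨ cong (_∧B (𝟘 ↣ y)) 𝟘↣𝟙≡𝟙 ⟩
    (𝟘 ↣ 𝟘) ∧B (𝟘 ↣ y)          ≡⟨ sym (b4 𝟘 𝟘 y) ⟩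
    𝟘 ↣ (𝟘 ∧B y)                ∎

  𝟘↣[x∧[𝟙∧y]]≡𝟘↣[x∧[𝟘∧y]] : ∀ x y → 𝟘 ↣ (x ∧B (𝟙 ∧B y)) ≡ 𝟘 ↣ (x ∧B (𝟘 ∧B y))
  𝟘↣[x∧[𝟙∧y]]≡𝟘↣[x∧[𝟘∧y]] x y = begin
    𝟘 ↣ (x ∧B (𝟙 ∧B y))                 ≡⟨ b4 𝟘 x (𝟙 ∧B y) ⟩
    (𝟘 ↣ x) ∧B (𝟘 ↣ (𝟙 ∧B y))           ≡⟨ cong ((𝟘 ↣ x) ∧B_) (𝟘↣[𝟙∧y]≡𝟘↣[𝟘∧y] y) ⟩
    (𝟘 ↣ x) ∧B (𝟘 ↣ (𝟘 ∧B y))           ≡⟨ sym (b4 𝟘 x (𝟘 ∧B y)) ⟩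
    𝟘 ↣ (x ∧B (𝟘 ∧B y))                 ∎

  𝟙∧∼[𝟙∧∼x]≡𝟙∧x : ∀ x → 𝟙 ∧B ∼B (𝟙 ∧B ∼B x) ≡ 𝟙 ∧B x
  𝟙∧∼[𝟙∧∼x]≡𝟙∧x x = trans (b3 𝟙 x) (cong (𝟙 ∧B_) (b1 𝟘 x))

  𝟙∧∼[𝟙∧x]≡𝟙∧∼x : ∀ x → 𝟙 ∧B ∼B (𝟙 ∧B x) ≡ 𝟙 ∧B ∼B x
  𝟙∧∼[𝟙∧x]≡𝟙∧∼x x =
    trans (cong (λ h → 𝟙 ∧B ∼B (𝟙 ∧B h)) (sym (∼-involutive x))) (𝟙∧∼[𝟙∧∼x]≡𝟙∧x (∼B x))

  𝟘↣[𝟘∧∼[𝟙∧∼y]]≡𝟘↣[𝟘∧y] : ∀ y → 𝟘 ↣ (𝟘 ∧B ∼B (𝟙 ∧B ∼B y)) ≡ 𝟘 ↣ (𝟘 ∧B y)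
  𝟘↣[𝟘∧∼[𝟙∧∼y]]≡𝟘↣[𝟘∧y] y = begin
    𝟘 ↣ (𝟘 ∧B ∼B (𝟙 ∧B ∼B y))       ≡⟨ sym (𝟘↣[𝟙∧y]≡𝟘↣[𝟘∧y] _) ⟩
    𝟘 ↣ (𝟙 ∧B ∼B (𝟙 ∧B ∼B y))       ≡⟨ cong (𝟘 ↣_) (𝟙∧∼[𝟙∧∼x]≡𝟙∧x y) ⟩
    𝟘 ↣ (𝟙 ∧B y)                    ≡⟨ 𝟘↣[𝟙∧y]≡𝟘↣[𝟘∧y] y ⟩
    𝟘 ↣ (𝟘 ∧B y)                    ∎

  𝟘↣[𝟘∧[𝟘∧x]]≡𝟘↣[𝟘∧x] : ∀ x → 𝟘 ↣ (𝟘 ∧B (𝟘 ∧B x)) ≡ 𝟘 ↣ (𝟘 ∧B x)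
  𝟘↣[𝟘∧[𝟘∧x]]≡𝟘↣[𝟘∧x] x = begin
    𝟘 ↣ (𝟘 ∧B (𝟘 ∧B x))                     ≡⟨ sym (𝟘↣[x∧[𝟙∧y]]≡𝟘↣[x∧[𝟘∧y]] 𝟘 x) ⟩
    𝟘 ↣ (𝟘 ∧B (𝟙 ∧B x))                     ≡⟨ sym (𝟘↣[𝟘∧∼[𝟙∧∼y]]≡𝟘↣[𝟘∧y] (𝟙 ∧B x)) ⟩
    𝟘 ↣ (𝟘 ∧B ∼B (𝟙 ∧B ∼B (𝟙 ∧B x)))        ≡⟨ cong (λ h → 𝟘 ↣ (𝟘 ∧B ∼B h)) (𝟙∧∼[𝟙∧x]≡𝟙∧∼x x) ⟩
    𝟘 ↣ (𝟘 ∧B ∼B (𝟙 ∧B ∼B x))               ≡⟨ 𝟘↣[𝟘∧∼[𝟙∧∼y]]≡𝟘↣[𝟘∧y] x ⟩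
    𝟘 ↣ (𝟘 ∧B x)                            ∎

  x↣x↣x↣x↣y≡x↣x↣y : ∀ x y → x ↣ (x ↣ (x ↣ (x ↣ y))) ≡ x ↣ (x ↣ y)
  x↣x↣x↣x↣y≡x↣x↣y x y = trans (b6 x x y) (cong (λ h → h ↣ (h ↣ y)) (∧-idem x))

  x↣x↣y↣y↣[x∧y]≡𝟘↣∼[x∧y] : ∀ x y → x ↣ (x ↣ (y ↣ (y ↣ (x ∧B y)))) ≡ 𝟘 ↣ ∼B (x ∧B y)
  x↣x↣y↣y↣[x∧y]≡𝟘↣∼[x∧y] x y = begin
    x ↣ (x ↣ (y ↣ (y ↣ (x ∧B y))))            ≡⟨ b6 x y (x ∧B y) ⟩
    (x ∧B y) ↣ ((x ∧B y) ↣ (x ∧B y))          ≡⟨ cong ((x ∧B y) ↣_) (x↣x≡𝟙 (x ∧B y)) ⟩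
    (x ∧B y) ↣ 𝟙                              ≡⟨ x↣𝟙≡𝟘↣∼x (x ∧B y) ⟩
    𝟘 ↣ ∼B (x ∧B y)                           ∎

  x↣[𝟘↣∼x]≡𝟘↣∼x : ∀ x → x ↣ (𝟘 ↣ ∼B x) ≡ 𝟘 ↣ ∼B x
  x↣[𝟘↣∼x]≡𝟘↣∼x x = begin
    x ↣ u               ≡⟨ sym x↣[x↣u]≡x↣u ⟩
    x ↣ (x ↣ u)         ≡⟨ cong (λ h → x ↣ (x ↣ h)) (sym (x↣𝟙≡𝟘↣∼x x)) ⟩
    x ↣ (x ↣ (x ↣ 𝟙))   ≡⟨ cong (λ h → x ↣ (x ↣ (x ↣ h))) (sym (x↣x≡𝟙 x)) ⟩
    x ↣ (x ↣ (x ↣ (x ↣ x)))   ≡⟨ x↣x↣x↣x↣y≡x↣x↣y x x ⟩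
    x ↣ (x ↣ x)         ≡⟨ cong (x ↣_) (x↣x≡𝟙 x) ⟩
    x ↣ 𝟙               ≡⟨ x↣𝟙≡𝟘↣∼x x ⟩
    u                   ∎
    where
    u : Carrier
    u = 𝟘 ↣ ∼B x

    ∼∼u∧∼x≡∼x : ∼B (∼B u) ∧B ∼B x ≡ ∼B x
    ∼∼u∧∼x≡∼x = trans (cong (_∧B ∼B x) (∼-involutive u)) (trans (∧-comm u (∼B x)) (x∧[𝟘↣x]≡x (∼B x)))

    -- (B7) for the pair ∼u, ∼x, whose meet is absorbed into ∼x.
    x↣[x↣u]≡x↣u : x ↣ (x ↣ u) ≡ x ↣ u
    x↣[x↣u]≡x↣u = begin
      x ↣ (x ↣ u)                               ≡⟨ cong₂ _↣_ (sym (∼-involutive x)) (b5 x u) ⟩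
      ∼B (∼B x) ↣ (∼B u ↣ ∼B x)                 ≡⟨ cong (λ h → ∼B h ↣ (∼B u ↣ ∼B x)) (sym ∼∼u∧∼x≡∼x) ⟩
      ∼B (∼B (∼B u) ∧B ∼B x) ↣ (∼B u ↣ ∼B x)    ≡⟨ b7 (∼B u) (∼B x) ⟩
      ∼B u ↣ ∼B x                               ≡⟨ sym (b5 x u) ⟩
      x ↣ u                                     ∎

  x↣[y∧[𝟘↣∼x]]≡x↣[y∧𝟙] : ∀ x y → x ↣ (y ∧B (𝟘 ↣ ∼B x)) ≡ x ↣ (y ∧B 𝟙)
  x↣[y∧[𝟘↣∼x]]≡x↣[y∧𝟙] x y = begin
    x ↣ (y ∧B (𝟘 ↣ ∼B x))               ≡⟨ b4 x y (𝟘 ↣ ∼B x) ⟩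
    (x ↣ y) ∧B (x ↣ (𝟘 ↣ ∼B x))         ≡⟨ cong ((x ↣ y) ∧B_) (x↣[𝟘↣∼x]≡𝟘↣∼x x) ⟩
    (x ↣ y) ∧B (𝟘 ↣ ∼B x)               ≡⟨ cong ((x ↣ y) ∧B_) (sym (x↣𝟙≡𝟘↣∼x x)) ⟩
    (x ↣ y) ∧B (x ↣ 𝟙)                  ≡⟨ sym (b4 x y 𝟙) ⟩
    x ↣ (y ∧B 𝟙)                        ∎

  𝟘↣[x∧∼x]≡𝟙 : ∀ x → 𝟘 ↣ (x ∧B ∼B x) ≡ 𝟙
  𝟘↣[x∧∼x]≡𝟙 x = begin
    𝟘 ↣ (x ∧B ∼B x)                     ≡⟨ cong (𝟘 ↣_) (∧-comm x (∼B x)) ⟩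
    𝟘 ↣ (∼B x ∧B x)                     ≡⟨ cong (𝟘 ↣_) (sym (∼-involutive (∼B x ∧B x))) ⟩
    𝟘 ↣ ∼B (∼B (∼B x ∧B x))             ≡⟨ sym (x↣𝟙≡𝟘↣∼x (∼B (∼B x ∧B x))) ⟩
    ∼B (∼B x ∧B x) ↣ 𝟙                  ≡⟨ cong (∼B (∼B x ∧B x) ↣_) (sym (x↣x≡𝟙 x)) ⟩
    ∼B (∼B x ∧B x) ↣ (x ↣ x)            ≡⟨ b7 x x ⟩
    x ↣ x                               ≡⟨ x↣x≡𝟙 x ⟩
    𝟙                                   ∎

  x↣[𝟘↣[𝟘∧x]]≡𝟘↣∼x : ∀ x → x ↣ (𝟘 ↣ (𝟘 ∧B x)) ≡ 𝟘 ↣ ∼B x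
  x↣[𝟘↣[𝟘∧x]]≡𝟘↣∼x x = begin
    x ↣ (𝟘 ↣ (𝟘 ∧B x))                  ≡⟨ cong (λ h → x ↣ (𝟘 ↣ h)) (∧-comm 𝟘 x) ⟩
    x ↣ (𝟘 ↣ (x ∧B 𝟘))                  ≡⟨ cong (x ↣_) (b4 𝟘 x 𝟘) ⟩
    x ↣ ((𝟘 ↣ x) ∧B 𝟙)                  ≡⟨ sym (x↣[y∧[𝟘↣∼x]]≡x↣[y∧𝟙] x (𝟘 ↣ x)) ⟩
    x ↣ ((𝟘 ↣ x) ∧B (𝟘 ↣ ∼B x))         ≡⟨ cong (x ↣_) (sym (b4 𝟘 x (∼B x))) ⟩
    x ↣ (𝟘 ↣ (x ∧B ∼B x))               ≡⟨ cong (x ↣_) (𝟘↣[x∧∼x]≡𝟙 x) ⟩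
    x ↣ 𝟙                               ≡⟨ x↣𝟙≡𝟘↣∼x x ⟩
    𝟘 ↣ ∼B x                            ∎

  [𝟘∧x]↣[𝟘↣[𝟘∧x]]≡𝟘↣∼[𝟘∧x] : ∀ x → (𝟘 ∧B x) ↣ (𝟘 ↣ (𝟘 ∧B x)) ≡ 𝟘 ↣ ∼B (𝟘 ∧B x)
  [𝟘∧x]↣[𝟘↣[𝟘∧x]]≡𝟘↣∼[𝟘∧x] x =
    trans (cong ((𝟘 ∧B x) ↣_) (sym (𝟘↣[𝟘∧[𝟘∧x]]≡𝟘↣[𝟘∧x] x))) (x↣[𝟘↣[𝟘∧x]]≡𝟘↣∼x (𝟘 ∧B x))

  𝟙∧[x↣[𝟘↣x]]≡𝟙 : ∀ x → 𝟙 ∧B (x ↣ (𝟘 ↣ x)) ≡ 𝟙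
  𝟙∧[x↣[𝟘↣x]]≡𝟙 x = begin
    𝟙 ∧B (x ↣ (𝟘 ↣ x))          ≡⟨ sym (x↣[x∧y]≡𝟙∧[x↣y] x (𝟘 ↣ x)) ⟩
    x ↣ (x ∧B (𝟘 ↣ x))          ≡⟨ cong (x ↣_) (x∧[𝟘↣x]≡x x) ⟩
    x ↣ x                       ≡⟨ x↣x≡𝟙 x ⟩
    𝟙                           ∎

  𝟘↣[𝟘∧[𝟘↣x]]≡𝟙 : ∀ x → 𝟘 ↣ (𝟘 ∧B (𝟘 ↣ x)) ≡ 𝟙
  𝟘↣[𝟘∧[𝟘↣x]]≡𝟙 x = begin
    𝟘 ↣ (𝟘 ∧B (𝟘 ↣ x))                          ≡⟨ cong (λ h → 𝟘 ↣ (𝟘 ∧B (𝟘 ↣ h))) (sym (∼-involutive x)) ⟩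
    𝟘 ↣ (𝟘 ∧B (𝟘 ↣ ∼B (∼B x)))                  ≡⟨ cong (𝟘 ↣_) (sym (x∧∼[x∧y]≡x∧[x↣∼y] 𝟘 (∼B x))) ⟩
    𝟘 ↣ (𝟘 ∧B ∼B (𝟘 ∧B ∼B x))                   ≡⟨ b4 𝟘 𝟘 (∼B (𝟘 ∧B ∼B x)) ⟩
    𝟙 ∧B (𝟘 ↣ ∼B (𝟘 ∧B ∼B x))                   ≡⟨ cong (𝟙 ∧B_) (sym ([𝟘∧x]↣[𝟘↣[𝟘∧x]]≡𝟘↣∼[𝟘∧x] (∼B x))) ⟩
    𝟙 ∧B ((𝟘 ∧B ∼B x) ↣ (𝟘 ↣ (𝟘 ∧B ∼B x)))      ≡⟨ 𝟙∧[x↣[𝟘↣x]]≡𝟙 (𝟘 ∧B ∼B x) ⟩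
    𝟙                                           ∎

  𝟘↣[𝟘↣[𝟘∧x]]≡𝟙 : ∀ x → 𝟘 ↣ (𝟘 ↣ (𝟘 ∧B x)) ≡ 𝟙
  𝟘↣[𝟘↣[𝟘∧x]]≡𝟙 x = begin
    𝟘 ↣ (𝟘 ↣ (𝟘 ∧B x))          ≡⟨ cong (λ h → 𝟘 ↣ (𝟘 ↣ h)) (∧-comm 𝟘 x) ⟩
    𝟘 ↣ (𝟘 ↣ (x ∧B 𝟘))          ≡⟨ cong (𝟘 ↣_) (b4 𝟘 x 𝟘) ⟩
    𝟘 ↣ ((𝟘 ↣ x) ∧B 𝟙)          ≡⟨ cong (𝟘 ↣_) (∧-comm (𝟘 ↣ x) 𝟙) ⟩
    𝟘 ↣ (𝟙 ∧B (𝟘 ↣ x))          ≡⟨ 𝟘↣[𝟙∧y]≡𝟘↣[𝟘∧y] (𝟘 ↣ x) ⟩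
    𝟘 ↣ (𝟘 ∧B (𝟘 ↣ x))          ≡⟨ 𝟘↣[𝟘∧[𝟘↣x]]≡𝟙 x ⟩
    𝟙                           ∎

  𝟘↣∼[𝟘∧x]≡𝟘↣∼x : ∀ x → 𝟘 ↣ ∼B (𝟘 ∧B x) ≡ 𝟘 ↣ ∼B x
  𝟘↣∼[𝟘∧x]≡𝟘↣∼x x = begin
    𝟘 ↣ ∼B (𝟘 ∧B x)                     ≡⟨ cong (λ h → 𝟘 ↣ ∼B h) (∧-comm 𝟘 x) ⟩
    𝟘 ↣ ∼B (x ∧B 𝟘)                     ≡⟨ sym (x↣x↣y↣y↣[x∧y]≡𝟘↣∼[x∧y] x 𝟘) ⟩
    x ↣ (x ↣ (𝟘 ↣ (𝟘 ↣ (x ∧B 𝟘))))      ≡⟨ cong (λ h → x ↣ (x ↣ (𝟘 ↣ (𝟘 ↣ h)))) (∧-comm x 𝟘) ⟩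
    x ↣ (x ↣ (𝟘 ↣ (𝟘 ↣ (𝟘 ∧B x))))      ≡⟨ cong (λ h → x ↣ (x ↣ h)) (𝟘↣[𝟘↣[𝟘∧x]]≡𝟙 x) ⟩
    x ↣ (x ↣ 𝟙)                         ≡⟨ cong (x ↣_) (x↣𝟙≡𝟘↣∼x x) ⟩
    x ↣ (𝟘 ↣ ∼B x)                      ≡⟨ x↣[𝟘↣∼x]≡𝟘↣∼x x ⟩
    𝟘 ↣ ∼B x                            ∎

  x↣[x↣[𝟘∧x]]≡x↣∼x : ∀ x → x ↣ (x ↣ (𝟘 ∧B x)) ≡ x ↣ ∼B x
  x↣[x↣[𝟘∧x]]≡x↣∼x x = begin
    x ↣ (x ↣ (𝟘 ∧B x))              ≡⟨ cong (x ↣_) (x↣[y∧x]≡𝟙∧[x↣y] x 𝟘) ⟩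
    x ↣ (𝟙 ∧B ∼B x)                 ≡⟨ cong (x ↣_) (∧-comm 𝟙 (∼B x)) ⟩
    x ↣ (∼B x ∧B 𝟙)                 ≡⟨ sym (x↣[y∧[𝟘↣∼x]]≡x↣[y∧𝟙] x (∼B x)) ⟩
    x ↣ (∼B x ∧B (𝟘 ↣ ∼B x))        ≡⟨ cong (x ↣_) (x∧[𝟘↣x]≡x (∼B x)) ⟩
    x ↣ ∼B x                        ∎

  𝟘↣𝟘↣𝟘↣x≡𝟘↣𝟘↣x : ∀ x → 𝟘 ↣ (𝟘 ↣ (𝟘 ↣ x)) ≡ 𝟘 ↣ (𝟘 ↣ x)
  𝟘↣𝟘↣𝟘↣x≡𝟘↣𝟘↣x x = begin
    𝟘 ↣ w                               ≡⟨ cong (𝟘 ↣_) (sym (x∧[𝟘↣x]≡x w)) ⟩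
    𝟘 ↣ (w ∧B (𝟘 ↣ w))                  ≡⟨ b4 𝟘 w (𝟘 ↣ w) ⟩
    (𝟘 ↣ w) ∧B (𝟘 ↣ (𝟘 ↣ w))            ≡⟨ cong ((𝟘 ↣ w) ∧B_) (x↣x↣x↣x↣y≡x↣x↣y 𝟘 x) ⟩
    (𝟘 ↣ w) ∧B w                        ≡⟨ sym (b4 𝟘 w (𝟘 ↣ x)) ⟩
    𝟘 ↣ (w ∧B (𝟘 ↣ x))                  ≡⟨ cong (𝟘 ↣_) (sym (b4 𝟘 (𝟘 ↣ x) x)) ⟩
    𝟘 ↣ (𝟘 ↣ ((𝟘 ↣ x) ∧B x))            ≡⟨ cong (λ h → 𝟘 ↣ (𝟘 ↣ h)) (∧-comm (𝟘 ↣ x) x) ⟩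
    𝟘 ↣ (𝟘 ↣ (x ∧B (𝟘 ↣ x)))            ≡⟨ cong (λ h → 𝟘 ↣ (𝟘 ↣ h)) (x∧[𝟘↣x]≡x x) ⟩
    w                                   ∎
    where
    w : Carrier
    w = 𝟘 ↣ (𝟘 ↣ x)

  𝟘↣𝟘↣x≡𝟘↣x : ∀ x → 𝟘 ↣ (𝟘 ↣ x) ≡ 𝟘 ↣ x
  𝟘↣𝟘↣x≡𝟘↣x x = begin
    𝟘 ↣ (𝟘 ↣ x)                     ≡⟨ cong (λ h → 𝟘 ↣ (𝟘 ↣ h)) (sym (∼-involutive x)) ⟩
    𝟘 ↣ (𝟘 ↣ ∼B z)                  ≡⟨ cong (𝟘 ↣_) (sym (𝟘↣∼[𝟘∧x]≡𝟘↣∼x z)) ⟩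
    𝟘 ↣ (𝟘 ↣ ∼B (𝟘 ∧B z))           ≡⟨ cong (𝟘 ↣_) (sym 𝟘↣𝟘↣[z↣∼z]≡𝟘↣∼[𝟘∧z]) ⟩
    𝟘 ↣ (𝟘 ↣ (𝟘 ↣ (z ↣ ∼B z)))      ≡⟨ 𝟘↣𝟘↣𝟘↣x≡𝟘↣𝟘↣x (z ↣ ∼B z) ⟩
    𝟘 ↣ (𝟘 ↣ (z ↣ ∼B z))            ≡⟨ 𝟘↣𝟘↣[z↣∼z]≡𝟘↣∼[𝟘∧z] ⟩
    𝟘 ↣ ∼B (𝟘 ∧B z)                 ≡⟨ 𝟘↣∼[𝟘∧x]≡𝟘↣∼x z ⟩
    𝟘 ↣ ∼B z                        ≡⟨ cong (𝟘 ↣_) (∼-involutive x) ⟩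
    𝟘 ↣ x                           ∎
    where
    z : Carrier
    z = ∼B x

    𝟘↣𝟘↣[z↣∼z]≡𝟘↣∼[𝟘∧z] : 𝟘 ↣ (𝟘 ↣ (z ↣ ∼B z)) ≡ 𝟘 ↣ ∼B (𝟘 ∧B z)
    𝟘↣𝟘↣[z↣∼z]≡𝟘↣∼[𝟘∧z] =
      trans (cong (λ h → 𝟘 ↣ (𝟘 ↣ h)) (sym (x↣[x↣[𝟘∧x]]≡x↣∼x z))) (x↣x↣y↣y↣[x∧y]≡𝟘↣∼[x∧y] 𝟘 z)

  𝟘↣[𝟘∧x]≡𝟙 : ∀ x → 𝟘 ↣ (𝟘 ∧B x) ≡ 𝟙
  𝟘↣[𝟘∧x]≡𝟙 x = trans (sym (𝟘↣𝟘↣x≡𝟘↣x (𝟘 ∧B x))) (𝟘↣[𝟘↣[𝟘∧x]]≡𝟙 x)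

  𝟘↣∼[x↣[𝟘↣x]]≡𝟙 : ∀ x → 𝟘 ↣ ∼B (x ↣ (𝟘 ↣ x)) ≡ 𝟙
  𝟘↣∼[x↣[𝟘↣x]]≡𝟙 x = begin
    𝟘 ↣ ∼B z                    ≡⟨ sym (x↣𝟙≡𝟘↣∼x z) ⟩
    z ↣ 𝟙                       ≡⟨ cong (z ↣_) (sym (x↣x≡𝟙 x)) ⟩
    z ↣ (x ↣ x)                 ≡⟨ cong (λ h → z ↣ (x ↣ h)) (sym (x∧[𝟘↣x]≡x x)) ⟩
    z ↣ (x ↣ (x ∧B (𝟘 ↣ x)))    ≡⟨ cong (z ↣_) (x↣[x∧y]≡𝟙∧[x↣y] x (𝟘 ↣ x)) ⟩
    z ↣ (𝟙 ∧B z)                ≡⟨ x↣[y∧x]≡𝟙∧[x↣y] z 𝟙 ⟩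
    𝟙 ∧B (z ↣ 𝟙)                ≡⟨ cong (𝟙 ∧B_) (x↣𝟙≡𝟘↣∼x z) ⟩
    𝟙 ∧B (𝟘 ↣ ∼B z)             ≡⟨ sym (b4 𝟘 𝟘 (∼B z)) ⟩
    𝟘 ↣ (𝟘 ∧B ∼B z)             ≡⟨ 𝟘↣[𝟘∧x]≡𝟙 (∼B z) ⟩
    𝟙                           ∎
    where
    z : Carrier
    z = x ↣ (𝟘 ↣ x)

  𝟘↣∼[𝟘↣x]≡𝟙 : ∀ x → 𝟘 ↣ ∼B (𝟘 ↣ x) ≡ 𝟙
  𝟘↣∼[𝟘↣x]≡𝟙 x = begin
    𝟘 ↣ ∼B (𝟘 ↣ x)                                ≡⟨ cong (λ h → 𝟘 ↣ ∼B (𝟘 ↣ h)) (sym (∼-involutive x)) ⟩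
    𝟘 ↣ ∼B (𝟘 ↣ ∼B (∼B x))                        ≡⟨ cong (λ h → 𝟘 ↣ ∼B h) (sym (𝟘↣∼[𝟘∧x]≡𝟘↣∼x (∼B x))) ⟩
    𝟘 ↣ ∼B (𝟘 ↣ ∼B (𝟘 ∧B ∼B x))                   ≡⟨ cong (λ h → 𝟘 ↣ ∼B h) (sym ([𝟘∧x]↣[𝟘↣[𝟘∧x]]≡𝟘↣∼[𝟘∧x] (∼B x))) ⟩
    𝟘 ↣ ∼B ((𝟘 ∧B ∼B x) ↣ (𝟘 ↣ (𝟘 ∧B ∼B x)))      ≡⟨ 𝟘↣∼[x↣[𝟘↣x]]≡𝟙 (𝟘 ∧B ∼B x) ⟩
    𝟙                                             ∎

  𝟙∧∼[𝟘↣x]≡∼[𝟘↣x] : ∀ x → 𝟙 ∧B ∼B (𝟘 ↣ x) ≡ ∼B (𝟘 ↣ x)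
  𝟙∧∼[𝟘↣x]≡∼[𝟘↣x] x = begin
    𝟙 ∧B n                  ≡⟨ ∧-comm 𝟙 n ⟩
    n ∧B 𝟙                  ≡⟨ cong (n ∧B_) (sym (𝟘↣∼[𝟘↣x]≡𝟙 x)) ⟩
    n ∧B (𝟘 ↣ n)            ≡⟨ x∧[𝟘↣x]≡x n ⟩
    n                       ∎
    where
    n : Carrier
    n = ∼B (𝟘 ↣ x)

  ∼[𝟘↣x]≡𝟘 : ∀ x → ∼B (𝟘 ↣ x) ≡ 𝟘
  ∼[𝟘↣x]≡𝟘 x = begin
    ∼B (𝟘 ↣ x)                      ≡⟨ sym (𝟙∧∼[𝟘↣x]≡∼[𝟘↣x] x) ⟩
    𝟙 ∧B ∼B (𝟘 ↣ x)                 ≡⟨ sym (𝟙∧∼[𝟙∧x]≡𝟙∧∼x (𝟘 ↣ x)) ⟩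
    𝟙 ∧B ∼B (𝟙 ∧B (𝟘 ↣ x))          ≡⟨ cong (λ h → 𝟙 ∧B ∼B h) (sym (b4 𝟘 𝟘 x)) ⟩
    𝟙 ∧B ∼B (𝟘 ↣ (𝟘 ∧B x))          ≡⟨ 𝟙∧∼[𝟘↣x]≡∼[𝟘↣x] (𝟘 ∧B x) ⟩
    ∼B (𝟘 ↣ (𝟘 ∧B x))               ≡⟨ cong ∼B (𝟘↣[𝟘∧x]≡𝟙 x) ⟩
    ∼B 𝟙                            ≡⟨ ∼𝟙≡𝟘 ⟩
    𝟘                               ∎

  𝟘↣x≡𝟙 : ∀ x → 𝟘 ↣ x ≡ 𝟙
  𝟘↣x≡𝟙 x = trans (sym (∼-involutive (𝟘 ↣ x))) (cong ∼B (∼[𝟘↣x]≡𝟘 x))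

  ∧-identityʳ : ∀ x → x ∧B 𝟙 ≡ x
  ∧-identityʳ x = trans (cong (x ∧B_) (sym (𝟘↣x≡𝟙 x))) (x∧[𝟘↣x]≡x x)

  ∧-identityˡ : ∀ x → 𝟙 ∧B x ≡ x
  ∧-identityˡ x = trans (∧-comm 𝟙 x) (∧-identityʳ x)

  x↣[∼x↣x]≡𝟙 : ∀ x → x ↣ (∼B x ↣ x) ≡ 𝟙
  x↣[∼x↣x]≡𝟙 x = begin
    x ↣ (∼B x ↣ x)                  ≡⟨ sym (∧-identityˡ _) ⟩
    𝟙 ∧B (x ↣ (∼B x ↣ x))           ≡⟨ sym (x↣[x∧y]≡𝟙∧[x↣y] x (∼B x ↣ x)) ⟩
    x ↣ (x ∧B (∼B x ↣ x))           ≡⟨ cong (x ↣_) (x∧[∼x↣x]≡x x) ⟩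
    x ↣ x                           ≡⟨ x↣x≡𝟙 x ⟩
    𝟙                               ∎

  [𝟘∧x]↣x≡𝟙 : ∀ x → (𝟘 ∧B x) ↣ x ≡ 𝟙
  [𝟘∧x]↣x≡𝟙 x = begin
    z ↣ x                           ≡⟨ sym (∧-identityˡ (z ↣ x)) ⟩
    𝟙 ∧B (z ↣ x)                    ≡⟨ sym (x↣[y∧x]≡𝟙∧[x↣y] z x) ⟩
    z ↣ (x ∧B z)                    ≡⟨ cong (z ↣_) (sym ∼z↣z≡x∧z) ⟩
    z ↣ (∼B z ↣ z)                  ≡⟨ x↣[∼x↣x]≡𝟙 z ⟩
    𝟙                               ∎
    where
    z : Carrier
    z = 𝟘 ∧B x

    ∼z↣z≡x∧z : ∼B z ↣ z ≡ x ∧B z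
    ∼z↣z≡x∧z = begin
      ∼B z ↣ (𝟘 ∧B x)       ≡⟨ ∼x↣𝟘∧y≡x∧[∼x↣y] z x ⟩
      z ∧B (∼B z ↣ x)       ≡⟨ cong (z ∧B_) (∼x↣y≡∼y↣x z x) ⟩
      z ∧B (∼B x ↣ z)       ≡⟨ cong (z ∧B_) (∼x↣[𝟘∧x]≡x x) ⟩
      z ∧B x                ≡⟨ ∧-comm z x ⟩
      x ∧B z                ∎

  ∧-zeroˡ : ∀ x → 𝟘 ∧B x ≡ 𝟘
  ∧-zeroˡ x = begin
    z                   ≡⟨ sym (∼-involutive z) ⟩
    ∼B (∼B z)           ≡⟨ cong ∼B ∼z≡𝟙 ⟩
    ∼B 𝟙                ≡⟨ ∼𝟙≡𝟘 ⟩
    𝟘                   ∎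
    where
    z : Carrier
    z = 𝟘 ∧B x

    ∼z≡𝟙 : ∼B z ≡ 𝟙
    ∼z≡𝟙 = begin
      z ↣ 𝟘                   ≡⟨ sym (∧-identityʳ (z ↣ 𝟘)) ⟩
      (z ↣ 𝟘) ∧B 𝟙            ≡⟨ cong ((z ↣ 𝟘) ∧B_) (sym ([𝟘∧x]↣x≡𝟙 x)) ⟩
      (z ↣ 𝟘) ∧B (z ↣ x)      ≡⟨ sym (b4 z 𝟘 x) ⟩
      z ↣ z                   ≡⟨ x↣x≡𝟙 z ⟩
      𝟙                       ∎

  b2 : B2 A
  b2 x y = begin
    (x ↣ y) ∧B y                ≡⟨ ∧-comm (x ↣ y) y ⟩
    y ∧B (x ↣ y)                ≡⟨ x∧[y↣x]≡∼[𝟘∧∼y]↣x y x ⟩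
    ∼B (𝟘 ∧B ∼B x) ↣ y          ≡⟨ cong (λ h → ∼B h ↣ y) (∧-zeroˡ (∼B x)) ⟩
    𝟙 ↣ y                       ≡⟨ b1 𝟘 y ⟩
    y                           ∎

  b8 : B8 A
  b8 x y = begin
    x ∧B (x ∨B y)               ≡⟨ b9 x x y ⟩
    (y ∧B x) ∨B (x ∧B x)        ≡⟨ cong ((y ∧B x) ∨B_) (trans (∧-idem x) (sym (∧-identityˡ x))) ⟩
    (y ∧B x) ∨B (𝟙 ∧B x)        ≡⟨ sym (b9 x 𝟙 y) ⟩
    x ∧B (𝟙 ∨B y)               ≡⟨ cong (x ∧B_) 𝟙∨y≡𝟙 ⟩
    x ∧B 𝟙                      ≡⟨ ∧-identityʳ x ⟩
    x                           ∎
    where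
    𝟙∨y≡𝟙 : 𝟙 ∨B y ≡ 𝟙
    𝟙∨y≡𝟙 = trans (cong (λ h → ∼B (h ∧B ∼B y)) ∼𝟙≡𝟘) (cong ∼B (∧-zeroˡ (∼B y)))

mainTheorem2 : {a : Level} (A : Algebra220 a) → (IsBrignole A → SatisfiesReduced A) × (SatisfiesReduced A → IsBrignole A)
mainTheorem2 A = forget , extend
  where
  forget : IsBrignole A → SatisfiesReduced A
  forget B = record { b1 = b1 ; b3 = b3 ; b4 = b4 ; b5 = b5 ; b6 = b6 ; b7 = b7 ; b9 = b9 ; b10 = b10 }
    where open IsBrignole B

  extend : SatisfiesReduced A → IsBrignole A
  extend S = record
    { b1 = b1 ; b2 = b2 ; b3 = b3 ; b4 = b4 ; b5 = b5 ; b6 = b6 ; b7 = b7 ; b8 = b8 ; b9 = b9 ; b10 = b10 }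
    where
    open SatisfiesReduced S
    open ReducedAxiomsConsequences A S
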